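{- For all positive integers $n$ and $k$, \[ \mathrm{MOF}_k(K_n) \geq \Big\lceil \frac{n}{k+1} \Big\rceil. \]
   Context: An orientation of a simple graph $G$ assigns to each edge $\{u,v\}$ exactly one of the arcs $(u,v)$ or $(v,u)$; if $(u,v)$ is an arc, $v$ is an out-neighbor of $u$. Oriented $k$-forcing: given an orientation $D$ and a set $S$ of initially colored vertices (all others non-colored), the $k$-color change rule says that any colored vertex having at most $k$ non-colored out-neighbors forces all of these out-neighbors to become colored; this rule is applied iteratively as long as possible. $S$ is an oriented $k$-forcing set of $D$ if at the end every vertex is colored. $F_k(D)$ is the minimum size of an oriented $k$-forcing set of $D$, and $\mathrm{MOF}_k(G)$ is the maximum of $F_k(D)$ over all orientations $D$ of $G$. $K_n$ is the complete graph on $n$ vertices. -}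

module Defs where

open import Data.Nat using (ℕ; zero; suc; _+_; _≤_)
open import Data.Nat.DivMod using (_/_)
open import Data.Bool using (Bool; true; false; not)
open import Data.Fin using (Fin)
open import Data.Fin.Subset using (Subset; _∈_; _∪_; _∩_; ∁; ∣_∣; ⊤)
open import Data.Vec using (tabulate)
open import Data.Product using (Σ; ∃; _×_; _,_)
open import Relation.Binary.PropositionalEquality using (_≡_; _≢_)
open import Relation.Binary.Construct.Closure.ReflexiveTransitive using (Star)

-- An orientation of the complete graph K_n on vertex set Fin n:
-- arc u v ≡ true means (u,v) is an arc. No loops, and for every
-- pair of distinct vertices exactly one of (u,v), (v,u) is an arc.
record OrientationKn (n : ℕ) : Set where
  field
    arc     : Fin n → Fin n → Bool
    noLoop  : ∀ u → arc u u ≡ false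
    oneWay  : ∀ u v → u ≢ v → arc v u ≡ not (arc u v)

open OrientationKn public

outNbhd : ∀ {n} → OrientationKn n → Fin n → Subset n
outNbhd D u = tabulate (λ v → arc D u v)

data ForceStep {n : ℕ} (D : OrientationKn n) (k : ℕ) : Subset n → Subset n → Set where
  force : ∀ {C} u → u ∈ C → ∣ outNbhd D u ∩ ∁ C ∣ ≤ k →
          ForceStep D k C (C ∪ outNbhd D u)

-- S is an oriented k-forcing set of D: iterating the rule from S
-- can colour every vertex.  (The rule is monotone, so the final colored set
-- is independent of the order of forces; reachability of ⊤ is equivalent
-- to "at the end every vertex is colored".)
IsForcingSet : ∀ {n} → OrientationKn n → ℕ → Subset n → Set
IsForcingSet D k S = Star (ForceStep D k) S ⊤

FkAtLeast : ∀ {n} → OrientationKn n → ℕ → ℕ → Set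
FkAtLeast D k m = ∀ S → IsForcingSet D k S → m ≤ ∣ S ∣

MOFKnAtLeast : ℕ → ℕ → ℕ → Set
MOFKnAtLeast n k m = Σ (OrientationKn n) (λ D → FkAtLeast D k m)

⌈_/suc_⌉ : ℕ → ℕ → ℕ
⌈ a /suc b ⌉ = (a + b) / suc b

module Submission where

-- The argument works for every transitive orientation D.  Fix a forcing
-- set S and follow a forcing sequence.  Call a vertex saturated when all
-- its out-neighbours are coloured; a force by a saturated vertex colours
-- nothing new.  By transitivity a vertex coloured by u has its
-- out-neighbours among those of u, so coloured vertices outside S stay
-- saturated, every force that colours something is performed by a vertex
-- of S, and that vertex is saturated from then on.  Hence each vertex of S
-- colours at most k new vertices in total: the invariant
-- ∣ C ∣ ≤ ∣ S ∣ + k * ∣ spent ∣ holds for a set spent ⊆ S of vertices that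
-- have already forced (record ForcingInvariant).  At the end every vertex
-- is coloured, so n ≤ (k+1) ∣ S ∣, and ceiling division finishes the proof.

open import Defs
open import Data.Nat using (ℕ; suc; _≤_; _+_; _*_; _<_; z≤n; s≤s)
open import Data.Nat.Properties
  using (≤-trans; ≤-pred; m≤m+n; +-monoʳ-≤; +-mono-≤; *-monoʳ-≤; +-assoc; +-comm; +-suc; +-identityʳ; *-comm; *-suc; module ≤-Reasoning)
open import Data.Nat.DivMod using (_/_; m<n*o⇒m/o<n)
open import Data.Bool using (true; false; not)
open import Data.Fin using (Fin) renaming (_<_ to _<ᶠ_)
open import Data.Fin.Properties using (_<?_; <-cmp; <-irrefl; <-trans)
open import Data.Fin.Subset using (Subset; _∈_; _∉_; _⊆_; _∪_; _∩_; ∁; ∣_∣; ⊤; ⁅_⁆; Empty)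
  renaming (⊥ to ∅)
open import Data.Fin.Subset.Properties
  using (_∈?_; _⊆?_; p⊆q⇒∣p∣≤∣q∣; p⊂q⇒∣p∣<∣q∣; p⊆p∪q; q⊆p∪q; x∈p∪q⁻; x∈p∪q⁺; x∈p∩q⁻; x∈∁p⇒x∉p; x∈⁅x⁆; x∈⁅y⁆⇒x≡y; ∉⊥; ∣⊥∣≡0; ∣⊤∣≡n; Empty-unique)
open import Data.Vec using ([]; _∷_)
open import Data.Vec.Properties using ([]=⇒lookup; lookup⇒[]=; lookup∘tabulate)
open import Data.Product using (_,_)
open import Data.Sum using (inj₂; [_,_])
open import Data.Empty using (⊥-elim)
open import Relation.Binary.Definitions using (tri<; tri≈; tri>)
open import Relation.Binary.PropositionalEquality using (_≡_; _≢_; refl; sym; trans; cong; subst)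
open import Relation.Binary.Construct.Closure.ReflexiveTransitive using (Star; ε; _◅_)
open import Relation.Nullary using (yes; no; does; ¬_)
open import Relation.Nullary.Decidable using (Dec; dec-true; dec-false)

∣p∪q∣≤∣p∣+∣q∩∁p∣ : ∀ {n} (p q : Subset n) → ∣ p ∪ q ∣ ≤ ∣ p ∣ + ∣ q ∩ ∁ p ∣
∣p∪q∣≤∣p∣+∣q∩∁p∣ []          []          = z≤n
∣p∪q∣≤∣p∣+∣q∩∁p∣ (true  ∷ p) (true  ∷ q) = s≤s (∣p∪q∣≤∣p∣+∣q∩∁p∣ p q)
∣p∪q∣≤∣p∣+∣q∩∁p∣ (true  ∷ p) (false ∷ q) = s≤s (∣p∪q∣≤∣p∣+∣q∩∁p∣ p q)
∣p∪q∣≤∣p∣+∣q∩∁p∣ (false ∷ p) (false ∷ q) = ∣p∪q∣≤∣p∣+∣q∩∁p∣ p q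
∣p∪q∣≤∣p∣+∣q∩∁p∣ (false ∷ p) (true  ∷ q) =
  subst (suc ∣ p ∪ q ∣ ≤_) (sym (+-suc ∣ p ∣ _)) (s≤s (∣p∪q∣≤∣p∣+∣q∩∁p∣ p q))

⊆⇒∣q∩∁p∣≡0 : ∀ {n} {p q : Subset n} → q ⊆ p → ∣ q ∩ ∁ p ∣ ≡ 0
⊆⇒∣q∩∁p∣≡0 {n} {p} {q} q⊆p = trans (cong ∣_∣ (Empty-unique nothingOutside)) (∣⊥∣≡0 n)
  where
  nothingOutside : Empty (q ∩ ∁ p)
  nothingOutside (x , x∈q∩∁p) with x∈p∩q⁻ q (∁ p) x∈q∩∁p
  ... | x∈q , x∈∁p = x∈∁p⇒x∉p x∈∁p (q⊆p x∈q)

∣p∪q∣≤∣p∣ : ∀ {n} (p q : Subset n) → q ⊆ p → ∣ p ∪ q ∣ ≤ ∣ p ∣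
∣p∪q∣≤∣p∣ p q q⊆p =
  subst (∣ p ∪ q ∣ ≤_) (trans (cong (∣ p ∣ +_) (⊆⇒∣q∩∁p∣≡0 q⊆p)) (+-identityʳ ∣ p ∣))
        (∣p∪q∣≤∣p∣+∣q∩∁p∣ p q)

∉⇒∣p∣<∣p∪⁅x⁆∣ : ∀ {n} {p : Subset n} {x} → x ∉ p → ∣ p ∣ < ∣ p ∪ ⁅ x ⁆ ∣
∉⇒∣p∣<∣p∪⁅x⁆∣ {x = x} x∉p =
  p⊂q⇒∣p∣<∣q∣ (p⊆p∪q _ , x , x∈p∪q⁺ (inj₂ (x∈⁅x⁆ x)) , x∉p)

∪-⊆ : ∀ {n} {p q r : Subset n} → p ⊆ r → q ⊆ r → p ∪ q ⊆ r
∪-⊆ {p = p} {q} p⊆r q⊆r x∈p∪q = [ p⊆r , q⊆r ] (x∈p∪q⁻ p q x∈p∪q)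

∈outNbhd⁺ : ∀ {n} (D : OrientationKn n) {u v} → arc D u v ≡ true → v ∈ outNbhd D u
∈outNbhd⁺ D {u} {v} uv = lookup⇒[]= v _ (trans (lookup∘tabulate (arc D u) v) uv)

∈outNbhd⁻ : ∀ {n} (D : OrientationKn n) {u v} → v ∈ outNbhd D u → arc D u v ≡ true
∈outNbhd⁻ D {u} {v} v∈ = trans (sym (lookup∘tabulate (arc D u) v)) ([]=⇒lookup v∈)

IsTransitive : ∀ {n} → OrientationKn n → Set
IsTransitive D = ∀ {u v w} → v ∈ outNbhd D u → w ∈ outNbhd D v → w ∈ outNbhd D u

module TransitiveBound {n : ℕ} (D : OrientationKn n) (transitive : IsTransitive D)
                       (k : ℕ) (S : Subset n) where

  Saturated : Subset n → Fin n → Set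
  Saturated C u = outNbhd D u ⊆ C

  saturated-mono : ∀ {C C'} → C ⊆ C' → ∀ {u} → Saturated C u → Saturated C' u
  saturated-mono C⊆C' sat w∈ = C⊆C' (sat w∈)

  record ForcingInvariant (C : Subset n) : Set where
    field
      spent            : Subset n
      spent⊆S          : spent ⊆ S
      spent-saturated  : ∀ {u} → u ∈ spent → Saturated C u
      others-saturated : ∀ {v} → v ∈ C → v ∉ S → Saturated C v
      size             : ∣ C ∣ ≤ ∣ S ∣ + k * ∣ spent ∣

  open ForcingInvariant

  initial : ForcingInvariant S
  initial = record
    { spent            = ∅
    ; spent⊆S          = λ x∈∅ → ⊥-elim (∉⊥ x∈∅)
    ; spent-saturated  = λ u∈∅ → ⊥-elim (∉⊥ u∈∅)
    ; others-saturated = λ v∈S v∉S → ⊥-elim (v∉S v∈S)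
    ; size             = m≤m+n ∣ S ∣ _
    }

  module AfterForce {C : Subset n} (u : Fin n) (u∈C : u ∈ C) (inv : ForcingInvariant C) where

    C' : Subset n
    C' = C ∪ outNbhd D u

    grow : C ⊆ C'
    grow = p⊆p∪q (outNbhd D u)

    spent-saturated' : ∀ {x} → x ∈ spent inv → Saturated C' x
    spent-saturated' x∈spent = saturated-mono grow (spent-saturated inv x∈spent)

    -- A newly coloured vertex v is an out-neighbour of u, so by
    -- transitivity its out-neighbours were coloured by the same force.
    others-saturated' : ∀ {v} → v ∈ C' → v ∉ S → Saturated C' v
    others-saturated' v∈C' v∉S =
      [ (λ v∈C → saturated-mono grow (others-saturated inv v∈C v∉S))
      , (λ v∈N⁺u w∈N⁺v → q⊆p∪q C _ (transitive v∈N⁺u w∈N⁺v))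
      ] (x∈p∪q⁻ C _ v∈C')

    saturatedForce : Saturated C u → ForcingInvariant C'
    saturatedForce u-sat = record
      { spent            = spent inv
      ; spent⊆S          = spent⊆S inv
      ; spent-saturated  = spent-saturated'
      ; others-saturated = others-saturated'
      ; size             = ≤-trans (∣p∪q∣≤∣p∣ C _ u-sat) (size inv)
      }

    -- A force by an unsaturated vertex is made by a fresh vertex of S,
    -- which joins spent after colouring at most k vertices.
    freshForce : ∣ outNbhd D u ∩ ∁ C ∣ ≤ k → ¬ Saturated C u → ForcingInvariant C'
    freshForce few u-unsat = record
      { spent            = spent inv ∪ ⁅ u ⁆
      ; spent⊆S          = ∪-⊆ (spent⊆S inv) (λ x∈⁅u⁆ → subst (_∈ S) (sym (x∈⁅y⁆⇒x≡y u x∈⁅u⁆)) u∈S)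
      ; spent-saturated  = λ {x} x∈spent' →
          [ (λ x∈spent → spent-saturated' x∈spent)
          , (λ x∈⁅u⁆ → subst (Saturated C') (sym (x∈⁅y⁆⇒x≡y u x∈⁅u⁆)) u-sat')
          ] (x∈p∪q⁻ (spent inv) _ x∈spent')
      ; others-saturated = others-saturated'
      ; size             = size'
      }
      where
      u∈S : u ∈ S
      u∈S with u ∈? S
      ... | yes u∈S = u∈S
      ... | no  u∉S = ⊥-elim (u-unsat (others-saturated inv u∈C u∉S))

      u∉spent : u ∉ spent inv
      u∉spent u∈spent = u-unsat (spent-saturated inv u∈spent)

      u-sat' : Saturated C' u
      u-sat' = q⊆p∪q C _

      size' : ∣ C' ∣ ≤ ∣ S ∣ + k * ∣ spent inv ∪ ⁅ u ⁆ ∣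
      size' = begin
        ∣ C' ∣                                  ≤⟨ ∣p∪q∣≤∣p∣+∣q∩∁p∣ C _ ⟩
        ∣ C ∣ + ∣ outNbhd D u ∩ ∁ C ∣            ≤⟨ +-mono-≤ (size inv) few ⟩
        ∣ S ∣ + k * ∣ spent inv ∣ + k            ≡⟨ +-assoc ∣ S ∣ _ k ⟩
        ∣ S ∣ + (k * ∣ spent inv ∣ + k)          ≡⟨ cong (∣ S ∣ +_) (+-comm _ k) ⟩
        ∣ S ∣ + (k + k * ∣ spent inv ∣)          ≡⟨ cong (∣ S ∣ +_) (sym (*-suc k _)) ⟩
        ∣ S ∣ + k * suc ∣ spent inv ∣            ≤⟨ +-monoʳ-≤ ∣ S ∣ (*-monoʳ-≤ k (∉⇒∣p∣<∣p∪⁅x⁆∣ u∉spent)) ⟩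
        ∣ S ∣ + k * ∣ spent inv ∪ ⁅ u ⁆ ∣        ∎
        where open ≤-Reasoning

  step : ∀ {C C'} → ForceStep D k C C' → ForcingInvariant C → ForcingInvariant C'
  step {C} (force u u∈C few) inv with outNbhd D u ⊆? C
  ... | yes u-sat   = AfterForce.saturatedForce u u∈C inv u-sat
  ... | no  u-unsat = AfterForce.freshForce u u∈C inv few u-unsat

  run : ∀ {C C'} → Star (ForceStep D k) C C' → ForcingInvariant C → ForcingInvariant C'
  run ε                  inv = inv
  run (forceStep ◅ rest) inv = run rest (step forceStep inv)

  forcingSetBound : IsForcingSet D k S → n ≤ suc k * ∣ S ∣
  forcingSetBound forcing = begin
    n                           ≡⟨ sym (∣⊤∣≡n n) ⟩
    ∣ ⊤ {n} ∣                   ≤⟨ size final ⟩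
    ∣ S ∣ + k * ∣ spent final ∣ ≤⟨ +-monoʳ-≤ ∣ S ∣ (*-monoʳ-≤ k (p⊆q⇒∣p∣≤∣q∣ (spent⊆S final))) ⟩
    ∣ S ∣ + k * ∣ S ∣           ∎
    where
    open ≤-Reasoning
    final : ForcingInvariant ⊤
    final = run forcing initial

does⇒witness : ∀ {A : Set} (a? : Dec A) → does a? ≡ true → A
does⇒witness (yes a) _  = a
does⇒witness (no _)  ()

transitiveTournament : ∀ n → OrientationKn n
transitiveTournament n = record
  { arc    = λ u v → does (u <? v)
  ; noLoop = λ u → dec-false (u <? u) (<-irrefl refl)
  ; oneWay = oneWay'
  }
  where
  oneWay' : ∀ (u v : Fin n) → u ≢ v → does (v <? u) ≡ not (does (u <? v))
  oneWay' u v u≢v with <-cmp u v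
  ... | tri< u<v _ v≮u = trans (dec-false (v <? u) v≮u) (cong not (sym (dec-true (u <? v) u<v)))
  ... | tri≈ _ u≡v _   = ⊥-elim (u≢v u≡v)
  ... | tri> u≮v _ v<u = trans (dec-true (v <? u) v<u) (cong not (sym (dec-false (u <? v) u≮v)))

transitiveTournament-transitive : ∀ n → IsTransitive (transitiveTournament n)
transitiveTournament-transitive n {u} {w = w} v∈ w∈ =
  ∈outNbhd⁺ D (dec-true (u <? w) (<-trans (arc⇒< v∈) (arc⇒< w∈)))
  where
  D = transitiveTournament n
  arc⇒< : ∀ {x y} → y ∈ outNbhd D x → x <ᶠ y
  arc⇒< {x} {y} y∈ = does⇒witness (x <? y) (∈outNbhd⁻ D y∈)

⌈/suc⌉-least : ∀ n k s → n ≤ suc k * s → ⌈ n /suc k ⌉ ≤ s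
⌈/suc⌉-least n k s n≤ = ≤-pred (m<n*o⇒m/o<n {n + k} {suc s} {suc k} n+k<)
  where
  n+k< : n + k < suc s * suc k
  n+k< = begin-strict
    n + k              ≡⟨ +-comm n k ⟩
    k + n              <⟨ s≤s (+-monoʳ-≤ k (subst (n ≤_) (*-comm (suc k) s) n≤)) ⟩
    suc k + s * suc k  ∎
    where open ≤-Reasoning

corollary2 : ∀ (n k : ℕ) → 1 ≤ n → 1 ≤ k → MOFKnAtLeast n k ⌈ n /suc k ⌉
corollary2 n k _ _ = D , λ S forcing →
  ⌈/suc⌉-least n k ∣ S ∣ (TransitiveBound.forcingSetBound D (transitiveTournament-transitive n) k S forcing)
  where
  D : OrientationKn n
  D = transitiveTournament n
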